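{- Let $k\ge 1$ be an integer and let $n$ be an odd positive integer with $\sigma(n)=2^k n$. Write $n={\Pi}\, q^{2\beta}\prod_{i=1}^{s}p_i^{2\beta_i}$, where ${\Pi}$ is the Euler part of $n$, $\beta,\beta_1,\dots,\beta_s$ are positive integers ($s\ge 0$), and $q,p_1,\dots,p_s$ are distinct odd primes (none dividing ${\Pi}$). Then $q^{2\beta}\mid \sigma({\Pi})$ if and only if, for every $i=1,\dots,s$: $$\begin{cases}2\beta_i+1\not\equiv 0 \pmod{\operatorname{ord}_q(p_i)}, & \text{if } p_i\not\equiv 1 \pmod q,\\ 2\beta_i+1\not\equiv 0 \pmod q, & \text{if } p_i\equiv 1 \pmod q,\end{cases}$$ where $\operatorname{ord}_q(m)$ is the multiplicative order of $m$ modulo $q$.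
   Context: $\sigma(m)$ denotes the sum of the positive divisors of $m$. For an odd positive integer $n$, its Euler part ${\Pi}$ is the product of all prime powers $p^e$ with $p^e\parallel n$ (i.e. $p^e\mid n$, $p^{e+1}\nmid n$) and $e$ odd; thus $n={\Pi}M^2$ with $\gcd({\Pi},M)=1$ and every prime dividing $M$ has even exponent in $n$. -}

module Defs where

open import Data.Nat using (ℕ; zero; suc; _+_; _*_; _^_; _≤_; _<_; ∣_-_∣)
open import Data.Nat.Divisibility using (_∣_; _∣?_)
open import Data.Nat.Primality using (Prime)
open import Data.Fin using (Fin; zero; suc)
open import Data.Product using (Σ; _×_)
open import Relation.Nullary using (¬_; yes; no)
open import Relation.Binary.PropositionalEquality using (_≡_; _≢_)
open import Function.Bundles using (_⇔_)

sumDivUpTo : ℕ → ℕ → ℕ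
sumDivUpTo zero    m = 0
sumDivUpTo (suc d) m with suc d ∣? m
... | yes _ = suc d + sumDivUpTo d m
... | no  _ = sumDivUpTo d m

σ : ℕ → ℕ
σ m = sumDivUpTo m m

∏ : (s : ℕ) → (Fin s → ℕ) → ℕ
∏ zero    f = 1
∏ (suc s) f = f zero * ∏ s (λ i → f (suc i))

Odd : ℕ → Set
Odd e = Σ ℕ λ t → e ≡ suc (2 * t)

infix 4 _^_∥_
_^_∥_ : ℕ → ℕ → ℕ → Set
p ^ e ∥ m = (p ^ e ∣ m) × ¬ (p ^ suc e ∣ m)

-- Π is the Euler part of n: the product of all prime powers p^e ∥ n with e odd.
IsEulerPart : ℕ → ℕ → Set
IsEulerPart n Π = (Π ≢ 0) × (∀ p e → Prime p → 1 ≤ e → (p ^ e ∥ Π) ⇔ ((p ^ e ∥ n) × Odd e))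

infix 4 _≅_[mod_]
_≅_[mod_] : ℕ → ℕ → ℕ → Set
a ≅ b [mod q ] = q ∣ ∣ a - b ∣

IsMultOrder : ℕ → ℕ → ℕ → Set
IsMultOrder q m d = (1 ≤ d) × (m ^ d ≅ 1 [mod q ]) × (∀ d′ → 1 ≤ d′ → d′ < d → ¬ (m ^ d′ ≅ 1 [mod q ]))

{-# OPTIONS --safe #-}
module Submission where

-- Multiplicativity of σ turns σ(n) = 2^k n into σ(Π) · σ(q^{2β}) · ∏ σ(pᵢ^{2βᵢ}) = q^{2β} · r
-- with q ∤ r. As σ(q^{2β}) ≡ 1 (mod q), q^{2β} ∣ σ(Π) exactly when q divides no
-- σ(pᵢ^{2βᵢ}) = 1 + pᵢ + ⋯ + pᵢ^{2βᵢ}. If pᵢ ≡ 1 (mod q) that sum is ≡ 2βᵢ + 1; otherwise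
-- q divides it iff q ∣ pᵢ^{2βᵢ+1} − 1, i.e. iff ord_q(pᵢ) ∣ 2βᵢ + 1.

open import Defs
open import Level using (0ℓ)
open import Data.Nat using (ℕ; zero; suc; _+_; _*_; _∸_; _^_; _≤_; _<_; z≤n; s≤s; NonZero; _≤?_; _%_; _/_; ≢-nonZero; ≢-nonZero⁻¹; nonTrivial⇒≢1)
open import Data.Nat.Properties
open import Data.Nat.DivMod using (m≡m%n+[m/n]*n; m%n<n)
open import Data.Nat.Divisibility
open import Data.Nat.Primality using (Prime; prime[2]; prime⇒nonZero; prime⇒nonTrivial; prime⇒irreducible; euclidsLemma)
open import Data.Nat.Coprimality using (Coprime; coprime-divisor)
open import Data.Nat.Tactic.RingSolver using (solve-∀)
open import Data.Fin using (Fin; zero; suc)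
import Data.Fin.Properties as Fin
open import Data.Product using (∃; ∃-syntax; _×_; _,_)
open import Data.Sum using (_⊎_; inj₁; inj₂; [_,_]′)
open import Data.Empty using (⊥-elim)
open import Function.Base using (_∘_; _$_; flip)
open import Function.Bundles using (_⇔_; mk⇔; Equivalence)
open import Function.Properties.Equivalence using (⇔-setoid)
open import Relation.Nullary using (¬_; Dec; yes; no)
open import Relation.Nullary.Decidable using (_×-dec_)
open import Relation.Unary using (Decidable)
open import Relation.Binary.PropositionalEquality
import Relation.Binary.Reasoning.Setoid as SetoidReasoning

open Equivalence using (to; from)

infixl 5 _when_

_when_ : {A : Set} → ℕ → Dec A → ℕ
x when yes _ = x
x when no  _ = 0

when-yes : ∀ {A : Set} (a? : Dec A) x → A → x when a? ≡ x
when-yes (yes _) x a = refl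
when-yes (no ¬a) x a = ⊥-elim (¬a a)

when-no : ∀ {A : Set} (a? : Dec A) x → ¬ A → x when a? ≡ 0
when-no (yes a) x ¬a = ⊥-elim (¬a a)
when-no (no _)  x ¬a = refl

0-when : ∀ {A : Set} (a? : Dec A) → 0 when a? ≡ 0
0-when (yes _) = refl
0-when (no _)  = refl

sumTo : ℕ → (ℕ → ℕ) → ℕ
sumTo zero    f = 0
sumTo (suc N) f = f (suc N) + sumTo N f

sumTo-cong : ∀ N {f g} → (∀ j → f j ≡ g j) → sumTo N f ≡ sumTo N g
sumTo-cong zero    f≗g = refl
sumTo-cong (suc N) f≗g = cong₂ _+_ (f≗g (suc N)) (sumTo-cong N f≗g)

sumTo-+ : ∀ N f g → sumTo N (λ j → f j + g j) ≡ sumTo N f + sumTo N g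
sumTo-+ zero    f g = refl
sumTo-+ (suc N) f g rewrite sumTo-+ N f g = interchange (f (suc N)) (g (suc N)) (sumTo N f) (sumTo N g)
  where
  interchange : ∀ a b c d → a + b + (c + d) ≡ a + c + (b + d)
  interchange = solve-∀

sumTo-* : ∀ N c f → sumTo N (λ j → c * f j) ≡ c * sumTo N f
sumTo-* zero    c f = sym (*-zeroʳ c)
sumTo-* (suc N) c f rewrite sumTo-* N c f = sym (*-distribˡ-+ c (f (suc N)) (sumTo N f))

sumTo-extend : ∀ r N f → (∀ j → N < j → j ≤ r + N → f j ≡ 0) → sumTo (r + N) f ≡ sumTo N f
sumTo-extend zero    N f f≡0 = refl
sumTo-extend (suc r) N f f≡0 =
  cong₂ _+_ (f≡0 (suc (r + N)) (s≤s (m≤n+m N r)) ≤-refl)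
            (sumTo-extend r N f (λ j N<j j≤r+N → f≡0 j N<j (m≤n⇒m≤1+n j≤r+N)))

sumTo-≤ : ∀ {N N′} f → N ≤ N′ → (∀ j → N < j → f j ≡ 0) → sumTo N′ f ≡ sumTo N f
sumTo-≤ {N} {N′} f N≤N′ f≡0 =
  trans (cong (λ M → sumTo M f) (sym (m∸n+n≡m N≤N′)))
        (sumTo-extend (N′ ∸ N) N f (λ j N<j _ → f≡0 j N<j))

¬∣-between-multiples : ∀ N c j → N * c < j → j < suc N * c → ¬ (c ∣ j)
¬∣-between-multiples N c j N*c<j j<N*c+c (divides t refl) =
  <⇒≱ j<N*c+c (*-monoˡ-≤ c (*-cancelʳ-< c N t N*c<j))

sumTo-multiples : ∀ N c .{{_ : NonZero c}} f → (∀ j → ¬ (c ∣ j) → f j ≡ 0) →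
                  sumTo (N * c) f ≡ sumTo N (λ i → f (i * c))
sumTo-multiples zero    c       f f≡0 = refl
sumTo-multiples (suc N) (suc c) f f≡0 =
  cong (f (suc N * suc c) +_)
    (trans (sumTo-extend c (N * suc c) f
              (λ j lo hi → f≡0 j (¬∣-between-multiples N (suc c) j lo (s≤s hi))))
           (sumTo-multiples N (suc c) f f≡0))

^≢0 : ∀ {m} e → m ≢ 0 → m ^ e ≢ 0
^≢0 {m} e m≢0 = m≢0 ∘ m^n≡0⇒m≡0 m e

*≢0 : ∀ {a b} → a ≢ 0 → b ≢ 0 → a * b ≢ 0
*≢0 {a} a≢0 b≢0 = [ a≢0 , b≢0 ]′ ∘ m*n≡0⇒m≡0∨n≡0 a

prime⇒≢0 : ∀ {p} → Prime p → p ≢ 0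
prime⇒≢0 {p} p-prime = ≢-nonZero⁻¹ p {{prime⇒nonZero p-prime}}

prime≢1 : ∀ {p} → Prime p → p ≢ 1
prime≢1 p-prime = nonTrivial⇒≢1 {{prime⇒nonTrivial p-prime}}

prime∤1 : ∀ {p} → Prime p → ¬ (p ∣ 1)
prime∤1 p-prime = prime≢1 p-prime ∘ ∣1⇒≡1

∤⇒coprime : ∀ {p j} → Prime p → ¬ (p ∣ j) → Coprime j p
∤⇒coprime p-prime p∤j (d∣j , d∣p) with prime⇒irreducible p-prime d∣p
... | inj₁ d≡1  = d≡1
... | inj₂ refl = ⊥-elim (p∤j d∣j)

∣-*-prime^⇒∣ : ∀ {p j a} m → Prime p → ¬ (p ∣ j) → j ∣ a * p ^ m → j ∣ a
∣-*-prime^⇒∣ {a = a} zero    p-prime p∤j j∣a rewrite *-identityʳ a = j∣a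
∣-*-prime^⇒∣ {p} {j} {a} (suc m) p-prime p∤j j∣M =
  ∣-*-prime^⇒∣ m p-prime p∤j
    (coprime-divisor (∤⇒coprime p-prime p∤j) (subst (j ∣_) (swap a p (p ^ m)) j∣M))
  where
  swap : ∀ a p x → a * (p * x) ≡ p * (a * x)
  swap = solve-∀

prime∣^⇒∣ : ∀ {p m} e → Prime p → p ∣ m ^ e → p ∣ m
prime∣^⇒∣ zero p-prime p∣1 = ⊥-elim (prime∤1 p-prime p∣1)
prime∣^⇒∣ {m = m} (suc e) p-prime p∣m^e+1 with euclidsLemma m (m ^ e) p-prime p∣m^e+1
... | inj₁ p∣m   = p∣m
... | inj₂ p∣m^e = prime∣^⇒∣ e p-prime p∣m^e

prime∣prime⇒≡ : ∀ {p r} → Prime p → Prime r → p ∣ r → p ≡ r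
prime∣prime⇒≡ p-prime r-prime p∣r with prime⇒irreducible r-prime p∣r
... | inj₁ p≡1 = ⊥-elim (prime≢1 p-prime p≡1)
... | inj₂ p≡r = p≡r

prime∤prime^ : ∀ {r p} e → Prime r → Prime p → r ≢ p → ¬ (r ∣ p ^ e)
prime∤prime^ e r-prime p-prime r≢p = r≢p ∘ prime∣prime⇒≡ r-prime p-prime ∘ prime∣^⇒∣ e r-prime

prime∤* : ∀ {p a b} → Prime p → ¬ (p ∣ a) → ¬ (p ∣ b) → ¬ (p ∣ a * b)
prime∤* {a = a} {b} p-prime p∤a p∤b = [ p∤a , p∤b ]′ ∘ euclidsLemma a b p-prime

prime∤*⇔∤ʳ : ∀ {p a b} → Prime p → ¬ (p ∣ a) → (¬ (p ∣ a * b)) ⇔ (¬ (p ∣ b))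
prime∤*⇔∤ʳ {a = a} p-prime p∤a = mk⇔ (λ p∤ab → p∤ab ∘ ∣n⇒∣m*n a) (prime∤* p-prime p∤a)

prime^∣*⇒∣ : ∀ {q} m a {b} → Prime q → ¬ (q ∣ b) → q ^ m ∣ a * b → q ^ m ∣ a
prime^∣*⇒∣     zero    a     q-prime q∤b _ = 1∣ a
prime^∣*⇒∣ {q} (suc m) a {b} q-prime q∤b q^m+1∣ab
  with euclidsLemma a b q-prime (∣-trans (m∣m*n (q ^ m)) q^m+1∣ab)
... | inj₂ q∣b = ⊥-elim (q∤b q∣b)
... | inj₁ (divides c refl) =
  subst (q * q ^ m ∣_) (*-comm q c)
    (*-monoʳ-∣ q (prime^∣*⇒∣ m c q-prime q∤b
      (*-cancelˡ-∣ q {{prime⇒nonZero q-prime}} (subst (q * q ^ m ∣_) (regroup c q b) q^m+1∣ab))))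
  where
  regroup : ∀ c q b → c * q * b ≡ q * (c * b)
  regroup = solve-∀

prime^∣⇔∤ : ∀ {q} m {a c r} → Prime q → ¬ (q ∣ r) → a * c ≡ q ^ m * r → (q ^ m ∣ a) ⇔ (¬ (q ∣ c))
prime^∣⇔∤ {q} m {a} {c} {r} q-prime q∤r ac≡q^m*r = mk⇔
  (λ q^m∣a q∣c → q∤r (*-cancelˡ-∣ (q ^ m) {{m^n≢0 q m {{prime⇒nonZero q-prime}}}}
                       (subst (q ^ m * q ∣_) ac≡q^m*r (*-pres-∣ q^m∣a q∣c))))
  (λ q∤c → prime^∣*⇒∣ m a q-prime q∤c (subst (q ^ m ∣_) (sym ac≡q^m*r) (m∣m*n r)))

∏≢0 : ∀ s {f : Fin s → ℕ} → (∀ i → f i ≢ 0) → ∏ s f ≢ 0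
∏≢0 zero    f≢0 = λ ()
∏≢0 (suc s) f≢0 = *≢0 (f≢0 zero) (∏≢0 s (f≢0 ∘ suc))

∣∏ : ∀ s (f : Fin s → ℕ) i → f i ∣ ∏ s f
∣∏ (suc s) f zero    = m∣m*n _
∣∏ (suc s) f (suc i) = ∣n⇒∣m*n (f zero) (∣∏ s (f ∘ suc) i)

prime∣∏⇒∣ : ∀ {p} s (f : Fin s → ℕ) → Prime p → p ∣ ∏ s f → ∃[ i ] p ∣ f i
prime∣∏⇒∣ zero    f p-prime p∣1 = ⊥-elim (prime∤1 p-prime p∣1)
prime∣∏⇒∣ (suc s) f p-prime p∣∏ with euclidsLemma (f zero) (∏ s (f ∘ suc)) p-prime p∣∏
... | inj₁ p∣f0 = zero , p∣f0
... | inj₂ p∣∏′ with prime∣∏⇒∣ s (f ∘ suc) p-prime p∣∏′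
... | i , p∣fi = suc i , p∣fi

prime∤∏⇔ : ∀ {p} s (f : Fin s → ℕ) → Prime p → (¬ (p ∣ ∏ s f)) ⇔ (∀ i → ¬ (p ∣ f i))
prime∤∏⇔ s f p-prime = mk⇔
  (λ p∤∏ i → p∤∏ ∘ flip ∣-trans (∣∏ s f i))
  (λ p∤f p∣∏ → let i , p∣fi = prime∣∏⇒∣ s f p-prime p∣∏ in p∤f i p∣fi)

prime∤∏prime^ : ∀ {r} s (p e : Fin s → ℕ) → Prime r → (∀ i → Prime (p i)) → (∀ i → r ≢ p i) →
                ¬ (r ∣ ∏ s (λ i → p i ^ e i))
prime∤∏prime^ s p e r-prime p-prime r≢p =
  from (prime∤∏⇔ s _ r-prime) (λ i → prime∤prime^ (e i) r-prime (p-prime i) (r≢p i))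

∀-cong-⇔ : ∀ {s} {A B : Fin s → Set} → (∀ i → A i ⇔ B i) → (∀ i → A i) ⇔ (∀ i → B i)
∀-cong-⇔ A⇔B = mk⇔ (λ a i → to (A⇔B i) (a i)) (λ b i → from (A⇔B i) (b i))

geom : ℕ → ℕ → ℕ
geom x zero    = 1
geom x (suc e) = 1 + x * geom x e

geom-telescope : ∀ y e → y * geom (suc y) e + 1 ≡ suc y ^ suc e
geom-telescope y zero    = base y
  where
  base : ∀ y → y * 1 + 1 ≡ suc y * 1
  base = solve-∀
geom-telescope y (suc e) = trans (step y (geom (suc y) e)) (cong (suc y *_) (geom-telescope y e))
  where
  step : ∀ y g → y * (1 + suc y * g) + 1 ≡ suc y * (y * g + 1)
  step = solve-∀

^∸1≡*geom : ∀ y e → suc y ^ suc e ∸ 1 ≡ y * geom (suc y) e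
^∸1≡*geom y e = trans (cong (_∸ 1) (sym (geom-telescope y e))) (m+n∸n≡m (y * geom (suc y) e) 1)

geom≡suc+* : ∀ y e → ∃[ h ] geom (suc y) e ≡ suc e + y * h
geom≡suc+* y zero    = 0 , sym (cong suc (*-zeroʳ y))
geom≡suc+* y (suc e) with geom≡suc+* y e
... | h , g≡ = h + g , (begin
  1 + suc y * g              ≡⟨ expand y g ⟩
  1 + g + y * g              ≡⟨ cong (λ z → 1 + z + y * g) g≡ ⟩
  1 + (suc e + y * h) + y * g ≡⟨ collect y e h g ⟩
  suc (suc e) + y * (h + g)  ∎)
  where
  open ≡-Reasoning
  g : ℕ
  g = geom (suc y) e
  expand : ∀ y g → 1 + suc y * g ≡ 1 + g + y * g
  expand = solve-∀
  collect : ∀ y e h g → 1 + (suc e + y * h) + y * g ≡ suc (suc e) + y * (h + g)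
  collect = solve-∀

∤geom-self : ∀ {q} e → q ≢ 1 → ¬ (q ∣ geom q e)
∤geom-self zero    q≢1 q∣1 = q≢1 (∣1⇒≡1 q∣1)
∤geom-self {q} (suc e) q≢1 q∣geom =
  q≢1 (∣1⇒≡1 (∣m+n∣m⇒∣n (subst (q ∣_) (+-comm 1 (q * geom q e)) q∣geom) (m∣m*n (geom q e))))

divisorTerm : ℕ → ℕ → ℕ
divisorTerm m j = j when (j ∣? m)

σ≡sumTo : ∀ m → σ m ≡ sumTo m (divisorTerm m)
σ≡sumTo m = upTo m
  where
  upTo : ∀ d → sumDivUpTo d m ≡ sumTo d (divisorTerm m)
  upTo zero = refl
  upTo (suc d) with suc d ∣? m
  ... | yes _ = cong (suc d +_) (upTo d)
  ... | no  _ = upTo d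

-- A divisor of a * p ^ (1 + e) either divides a or is p times a divisor of a * p ^ e.
σ-*-prime^-suc : ∀ {p a} e → Prime p → a ≢ 0 → ¬ (p ∣ a) →
                 σ (a * p ^ suc e) ≡ σ a + p * σ (a * p ^ e)
σ-*-prime^-suc {p} {a} e p-prime a≢0 p∤a = begin
  σ M                                                      ≡⟨ σ≡sumTo M ⟩
  sumTo M (divisorTerm M)                                  ≡⟨ sumTo-cong M split ⟩
  sumTo M (λ j → divisorTerm a j + multipleTerm j)         ≡⟨ sumTo-+ M _ _ ⟩
  sumTo M (divisorTerm a) + sumTo M multipleTerm           ≡⟨ cong₂ _+_ (sumTo-≤ _ a≤M beyond-a)
                                                                (cong (λ N → sumTo N multipleTerm) M≡A*p) ⟩
  sumTo a (divisorTerm a) + sumTo (A * p) multipleTerm     ≡⟨ cong₂ _+_ (sym (σ≡sumTo a))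
                                                                (sumTo-multiples A p _ (λ j → when-no (p ∣? j) _)) ⟩
  σ a + sumTo A (λ i → multipleTerm (i * p))               ≡⟨ cong (σ a +_) (sumTo-cong A scaled) ⟩
  σ a + sumTo A (λ i → p * divisorTerm A i)                ≡⟨ cong (σ a +_) (sumTo-* A p _) ⟩
  σ a + p * sumTo A (divisorTerm A)                        ≡⟨ cong (λ x → σ a + p * x) (sym (σ≡sumTo A)) ⟩
  σ a + p * σ A                                            ∎
  where
  open ≡-Reasoning
  instance
    p≢0 : NonZero p
    p≢0 = prime⇒nonZero p-prime
  A M : ℕ
  A = a * p ^ e
  M = a * p ^ suc e
  multipleTerm : ℕ → ℕ
  multipleTerm j = divisorTerm M j when (p ∣? j)
  M≡A*p : M ≡ A * p
  M≡A*p = reassoc a p (p ^ e)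
    where
    reassoc : ∀ a p x → a * (p * x) ≡ a * x * p
    reassoc = solve-∀
  a≤M : a ≤ M
  a≤M = m≤m*n a (p ^ suc e) {{m^n≢0 p (suc e)}}
  beyond-a : ∀ j → a < j → divisorTerm a j ≡ 0
  beyond-a j a<j = when-no (j ∣? a) j (<⇒≱ a<j ∘ ∣⇒≤ {{≢-nonZero a≢0}})
  split : ∀ j → divisorTerm M j ≡ divisorTerm a j + multipleTerm j
  split j with j ∣? M | j ∣? a | p ∣? j
  ... | yes _   | yes j∣a | yes p∣j = ⊥-elim (p∤a (∣-trans p∣j j∣a))
  ... | yes _   | yes _   | no  _   = sym (+-identityʳ j)
  ... | yes _   | no  _   | yes _   = refl
  ... | yes j∣M | no  j∤a | no  p∤j = ⊥-elim (j∤a (∣-*-prime^⇒∣ (suc e) p-prime p∤j j∣M))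
  ... | no  j∤M | yes j∣a | _       = ⊥-elim (j∤M (∣-trans j∣a (m∣m*n (p ^ suc e))))
  ... | no  _   | no  _   | yes _   = refl
  ... | no  _   | no  _   | no  _   = refl
  scaled : ∀ i → multipleTerm (i * p) ≡ p * divisorTerm A i
  scaled i with i * p ∣? M | i ∣? A
  ... | yes _     | yes _   = trans (when-yes (p ∣? (i * p)) (i * p) (n∣m*n i)) (*-comm i p)
  ... | yes ip∣M  | no  i∤A = ⊥-elim (i∤A (*-cancelʳ-∣ p (subst (i * p ∣_) M≡A*p ip∣M)))
  ... | no  ip∤M  | yes i∣A = ⊥-elim (ip∤M (subst (i * p ∣_) (sym M≡A*p) (*-monoˡ-∣ p i∣A)))
  ... | no  _     | no  _   = trans (0-when (p ∣? (i * p))) (sym (*-zeroʳ p))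

σ-*-prime^ : ∀ {p a} e → Prime p → a ≢ 0 → ¬ (p ∣ a) → σ (a * p ^ e) ≡ σ a * geom p e
σ-*-prime^ {p} {a} zero p-prime a≢0 p∤a rewrite *-identityʳ a | *-identityʳ (σ a) = refl
σ-*-prime^ {p} {a} (suc e) p-prime a≢0 p∤a = begin
  σ (a * p ^ suc e)           ≡⟨ σ-*-prime^-suc e p-prime a≢0 p∤a ⟩
  σ a + p * σ (a * p ^ e)     ≡⟨ cong (λ x → σ a + p * x) (σ-*-prime^ e p-prime a≢0 p∤a) ⟩
  σ a + p * (σ a * geom p e)  ≡⟨ factor (σ a) p (geom p e) ⟩
  σ a * geom p (suc e)        ∎
  where
  open ≡-Reasoning
  factor : ∀ s p g → s + p * (s * g) ≡ s * (1 + p * g)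
  factor = solve-∀

σ-*-∏-prime^ : ∀ s {a} (p e : Fin s → ℕ) → a ≢ 0 → (∀ i → Prime (p i)) → (∀ i → ¬ (p i ∣ a)) →
               (∀ i j → p i ≡ p j → i ≡ j) →
               σ (a * ∏ s (λ i → p i ^ e i)) ≡ σ a * ∏ s (λ i → geom (p i) (e i))
σ-*-∏-prime^ zero {a} p e a≢0 p-prime p∤a p-inj =
  trans (cong σ (*-identityʳ a)) (sym (*-identityʳ (σ a)))
σ-*-∏-prime^ (suc s) {a} p e a≢0 p-prime p∤a p-inj = begin
  σ (a * (p₀ ^ e₀ * R))            ≡⟨ cong σ (swap a (p₀ ^ e₀) R) ⟩
  σ (a * R * p₀ ^ e₀)              ≡⟨ σ-*-prime^ e₀ (p-prime zero) (*≢0 a≢0 R≢0) p₀∤aR ⟩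
  σ (a * R) * geom p₀ e₀           ≡⟨ cong (_* geom p₀ e₀) (σ-*-∏-prime^ s (p ∘ suc) (e ∘ suc) a≢0
                                        (p-prime ∘ suc) (p∤a ∘ suc)
                                        (λ i j eq → Fin.suc-injective (p-inj (suc i) (suc j) eq))) ⟩
  σ a * G * geom p₀ e₀             ≡⟨ swap′ (σ a) G (geom p₀ e₀) ⟩
  σ a * (geom p₀ e₀ * G)           ∎
  where
  open ≡-Reasoning
  p₀ e₀ R G : ℕ
  p₀ = p zero
  e₀ = e zero
  R = ∏ s (λ i → p (suc i) ^ e (suc i))
  G = ∏ s (λ i → geom (p (suc i)) (e (suc i)))
  swap : ∀ a x r → a * (x * r) ≡ a * r * x
  swap = solve-∀
  swap′ : ∀ a r x → a * r * x ≡ a * (x * r)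
  swap′ = solve-∀
  R≢0 : R ≢ 0
  R≢0 = ∏≢0 s (λ i → ^≢0 (e (suc i)) (prime⇒≢0 (p-prime (suc i))))
  p₀∤aR : ¬ (p₀ ∣ a * R)
  p₀∤aR = prime∤* (p-prime zero) (p∤a zero)
    (prime∤∏prime^ s (p ∘ suc) (e ∘ suc) (p-prime zero) (p-prime ∘ suc)
      (λ i p₀≡pᵢ → Fin.0≢1+n (p-inj zero (suc i) p₀≡pᵢ)))

σ-*-prime^-*-∏-prime^ : ∀ s {a q} e (p es : Fin s → ℕ) → a ≢ 0 → Prime q → ¬ (q ∣ a) →
                        (∀ i → Prime (p i)) → (∀ i → p i ≢ q) → (∀ i → ¬ (p i ∣ a)) →
                        (∀ i j → p i ≡ p j → i ≡ j) →
                        σ (a * q ^ e * ∏ s (λ i → p i ^ es i))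
                          ≡ σ a * (geom q e * ∏ s (λ i → geom (p i) (es i)))
σ-*-prime^-*-∏-prime^ s {a} {q} e p es a≢0 q-prime q∤a p-prime p≢q p∤a p-inj = begin
  σ (a * q ^ e * ∏ s (λ i → p i ^ es i))  ≡⟨ σ-*-∏-prime^ s p es aqᵉ≢0 p-prime p∤aqᵉ p-inj ⟩
  σ (a * q ^ e) * G                       ≡⟨ cong (_* G) (σ-*-prime^ e q-prime a≢0 q∤a) ⟩
  σ a * geom q e * G                      ≡⟨ *-assoc (σ a) (geom q e) G ⟩
  σ a * (geom q e * G)                    ∎
  where
  open ≡-Reasoning
  G : ℕ
  G = ∏ s (λ i → geom (p i) (es i))
  aqᵉ≢0 : a * q ^ e ≢ 0
  aqᵉ≢0 = *≢0 a≢0 (^≢0 e (prime⇒≢0 q-prime))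
  p∤aqᵉ : ∀ i → ¬ (p i ∣ a * q ^ e)
  p∤aqᵉ i = prime∤* (p-prime i) (p∤a i) (prime∤prime^ e (p-prime i) q-prime (p≢q i))

least-below : {P : ℕ → Set} → Decidable P → ∀ N →
              (∃[ d ] d < N × P d × (∀ {d′} → d′ < d → ¬ P d′)) ⊎ (∀ {d} → d < N → ¬ P d)
least-below P? zero = inj₂ λ ()
least-below P? (suc N) with least-below P? N
... | inj₁ (d , d<N , Pd , minimal) = inj₁ (d , m<n⇒m<1+n d<N , Pd , minimal)
... | inj₂ none with P? N
...   | yes PN  = inj₁ (N , ≤-refl , PN , none)
...   | no  ¬PN = inj₂ λ d<1+N → [ none , (λ { refl → ¬PN }) ]′ (m<1+n⇒m<n∨m≡n d<1+N)

least : {P : ℕ → Set} → Decidable P → ∀ {m} → P m → ∃[ d ] P d × (∀ {d′} → d′ < d → ¬ P d′)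
least P? {m} Pm with least-below P? (suc m)
... | inj₁ (d , _ , Pd , minimal) = d , Pd , minimal
... | inj₂ none                   = ⊥-elim (none ≤-refl Pm)

≅1⇔∣∸1 : ∀ {q} x → x ≢ 0 → (x ≅ 1 [mod q ]) ⇔ (q ∣ x ∸ 1)
≅1⇔∣∸1     zero    x≢0 = ⊥-elim (x≢0 refl)
≅1⇔∣∸1 {q} (suc y) _   = mk⇔ (subst (q ∣_) (∣-∣-identityʳ y)) (subst (q ∣_) (sym (∣-∣-identityʳ y)))

∸1∣^∸1 : ∀ x m → x ∸ 1 ∣ x ^ m ∸ 1
∸1∣^∸1 zero    zero    = _ ∣0
∸1∣^∸1 zero    (suc m) = _ ∣0
∸1∣^∸1 (suc y) zero    = _ ∣0
∸1∣^∸1 (suc y) (suc m) = subst (y ∣_) (sym (^∸1≡*geom y m)) (m∣m*n _)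

∣*∸1-cancelʳ : ∀ {q} x y → y ≢ 0 → q ∣ x * y ∸ 1 → q ∣ y ∸ 1 → q ∣ x ∸ 1
∣*∸1-cancelʳ     zero    y       y≢0 _      _      = _ ∣0
∣*∸1-cancelʳ     (suc x) zero    y≢0 _      _      = ⊥-elim (y≢0 refl)
∣*∸1-cancelʳ {q} (suc x) (suc y) _   q∣xy∸1 q∣y∸1 =
  ∣m+n∣m⇒∣n (subst (q ∣_) (regroup x y) q∣xy∸1) (∣n⇒∣m*n (suc x) q∣y∸1)
  where
  regroup : ∀ x y → y + x * suc y ≡ suc x * y + x
  regroup = solve-∀

order∣⇒∣^∸1 : ∀ {q x d m} → x ≢ 0 → IsMultOrder q x d → d ∣ m → q ∣ x ^ m ∸ 1
order∣⇒∣^∸1 {q} {x} {d} x≢0 (_ , x^d≅1 , _) (divides t refl) =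
  subst (λ z → q ∣ z ∸ 1) (trans (^-*-assoc x d t) (cong (x ^_) (*-comm d t)))
    (∣-trans (to (≅1⇔∣∸1 _ (^≢0 d x≢0)) x^d≅1) (∸1∣^∸1 (x ^ d) t))

-- Divide m by the order d: the remainder r satisfies x ^ r ≡ 1 mod q, so by minimality r = 0.
∣^∸1⇒order∣ : ∀ {q x d m} → x ≢ 0 → IsMultOrder q x d → q ∣ x ^ m ∸ 1 → d ∣ m
∣^∸1⇒order∣ {d = zero} x≢0 (() , _)
∣^∸1⇒order∣ {q} {x} {d@(suc _)} {m} x≢0 order@(_ , _ , minimal) q∣x^m∸1 =
  divideBy (m % d) (m / d) (m≡m%n+[m/n]*n m d) (m%n<n m d)
  where
  divideBy : ∀ r t → m ≡ r + t * d → r < d → d ∣ m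
  divideBy zero    t m≡t*d _   = divides t m≡t*d
  divideBy (suc r) t m≡r+t*d r<d = ⊥-elim $
    minimal (suc r) (s≤s z≤n) r<d
      (from (≅1⇔∣∸1 _ (^≢0 (suc r) x≢0))
        (∣*∸1-cancelʳ (x ^ suc r) (x ^ (t * d)) (^≢0 (t * d) x≢0)
          (subst (λ z → q ∣ z ∸ 1) (trans (cong (x ^_) m≡r+t*d) (^-distribˡ-+-* x (suc r) (t * d))) q∣x^m∸1)
          (order∣⇒∣^∸1 x≢0 order (n∣m*n t))))

order-exists : ∀ {q x m} → x ≢ 0 → 1 ≤ m → q ∣ x ^ m ∸ 1 → ∃ (IsMultOrder q x)
order-exists {q} {x} x≢0 1≤m q∣x^m∸1
  with least (λ d → 1 ≤? d ×-dec q ∣? x ^ d ∸ 1) (1≤m , q∣x^m∸1)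
... | d , (1≤d , q∣x^d∸1) , minimal =
  d , 1≤d , from (≅1⇔∣∸1 _ (^≢0 d x≢0)) q∣x^d∸1 ,
  λ d′ 1≤d′ d′<d x^d′≅1 → minimal d′<d (1≤d′ , to (≅1⇔∣∸1 _ (^≢0 d′ x≢0)) x^d′≅1)

∣geom⇔∣suc : ∀ {q y} e → q ∣ y → (q ∣ geom (suc y) e) ⇔ (q ∣ suc e)
∣geom⇔∣suc {q} {y} e q∣y with geom≡suc+* y e
... | h , geom≡ = mk⇔
  (λ q∣geom → ∣m+n∣m⇒∣n (subst (q ∣_) (trans geom≡ (+-comm (suc e) (y * h))) q∣geom) q∣yh)
  (λ q∣suc-e → subst (q ∣_) (sym geom≡) (∣m∣n⇒∣m+n q∣suc-e q∣yh))
  where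
  q∣yh : q ∣ y * h
  q∣yh = ∣m⇒∣m*n h q∣y

∣geom⇔∣^∸1 : ∀ {q y} e → Prime q → ¬ (q ∣ y) → (q ∣ geom (suc y) e) ⇔ (q ∣ suc y ^ suc e ∸ 1)
∣geom⇔∣^∸1 {q} {y} e q-prime q∤y = mk⇔
  (λ q∣geom → subst (q ∣_) (sym (^∸1≡*geom y e)) (∣n⇒∣m*n y q∣geom))
  (λ q∣^∸1 → [ ⊥-elim ∘ q∤y , (λ q∣geom → q∣geom) ]′
               (euclidsLemma y (geom (suc y) e) q-prime (subst (q ∣_) (^∸1≡*geom y e) q∣^∸1)))

OrderCondition : ℕ → ℕ → ℕ → Set
OrderCondition q p m =
  (¬ (p ≅ 1 [mod q ]) → ∀ d → IsMultOrder q p d → ¬ (d ∣ m)) × (p ≅ 1 [mod q ] → ¬ (q ∣ m))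

∤geom⇔OrderCondition : ∀ {q p} e → Prime q → p ≢ 0 → (¬ (q ∣ geom p e)) ⇔ OrderCondition q p (suc e)
∤geom⇔OrderCondition {p = zero} e q-prime p≢0 = ⊥-elim (p≢0 refl)
∤geom⇔OrderCondition {q} {suc y} e q-prime _ = byCase (q ∣? y)
  where
  p≅1⇔q∣y : (suc y ≅ 1 [mod q ]) ⇔ (q ∣ y)
  p≅1⇔q∣y = ≅1⇔∣∸1 (suc y) (λ ())
  byCase : Dec (q ∣ y) → (¬ (q ∣ geom (suc y) e)) ⇔ OrderCondition q (suc y) (suc e)
  byCase (yes q∣y) = mk⇔
    (λ q∤geom → (λ p≇1 → ⊥-elim (p≇1 (from p≅1⇔q∣y q∣y)))
              , (λ _ → q∤geom ∘ from (∣geom⇔∣suc e q∣y)))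
    (λ (_ , q∤suc-e) → q∤suc-e (from p≅1⇔q∣y q∣y) ∘ to (∣geom⇔∣suc e q∣y))
  byCase (no q∤y) = mk⇔
    (λ q∤geom → (λ _ d order → q∤geom ∘ from geom⇔^ ∘ order∣⇒∣^∸1 (λ ()) order)
              , (λ p≅1 → ⊥-elim (q∤y (to p≅1⇔q∣y p≅1))))
    (λ (order∤suc-e , _) q∣geom →
      let q∣^∸1     = to geom⇔^ q∣geom
          d , order = order-exists {m = suc e} (λ ()) (s≤s z≤n) q∣^∸1
      in order∤suc-e (q∤y ∘ to p≅1⇔q∣y) d order (∣^∸1⇒order∣ (λ ()) order q∣^∸1))
    where
    geom⇔^ : (q ∣ geom (suc y) e) ⇔ (q ∣ suc y ^ suc e ∸ 1)
    geom⇔^ = ∣geom⇔∣^∸1 e q-prime q∤y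

theorem3p1 : (k n : ℕ) → 1 ≤ k → 1 ≤ n → Odd n → σ n ≡ 2 ^ k * n →
    (Π q β s : ℕ) (p βs : Fin s → ℕ) →
    IsEulerPart n Π →
    n ≡ Π * q ^ (2 * β) * ∏ s (λ i → p i ^ (2 * βs i)) →
    1 ≤ β → (∀ i → 1 ≤ βs i) →
    Prime q → q ≢ 2 → (∀ i → Prime (p i)) → (∀ i → p i ≢ 2) →
    (∀ i → p i ≢ q) → (∀ i j → p i ≡ p j → i ≡ j) →
    ¬ (q ∣ Π) → (∀ i → ¬ (p i ∣ Π)) →
    (q ^ (2 * β) ∣ σ Π) ⇔
      (∀ i → (¬ (p i ≅ 1 [mod q ]) → ∀ d → IsMultOrder q (p i) d → ¬ (d ∣ suc (2 * βs i)))
           × (p i ≅ 1 [mod q ] → ¬ (q ∣ suc (2 * βs i))))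
theorem3p1 k n _ _ _ σn≡2^kn Π q β s p βs (Π≢0 , _) n≡ _ _ q-prime q≢2 p-prime _ p≢q p-inj q∤Π p∤Π = chain
  where
  P G : ℕ
  P = ∏ s (λ i → p i ^ (2 * βs i))
  G = ∏ s (λ i → geom (p i) (2 * βs i))
  q∤cofactor : ¬ (q ∣ 2 ^ k * (Π * P))
  q∤cofactor = prime∤* q-prime (prime∤prime^ k q-prime prime[2] q≢2)
    (prime∤* q-prime q∤Π (prime∤∏prime^ s p (λ i → 2 * βs i) q-prime p-prime (λ i → p≢q i ∘ sym)))
  σ-factorisation : σ Π * (geom q (2 * β) * G) ≡ q ^ (2 * β) * (2 ^ k * (Π * P))
  σ-factorisation = begin
    σ Π * (geom q (2 * β) * G)       ≡⟨ σ-*-prime^-*-∏-prime^ s (2 * β) p (λ i → 2 * βs i)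
                                          Π≢0 q-prime q∤Π p-prime p≢q p∤Π p-inj ⟨
    σ (Π * q ^ (2 * β) * P)          ≡⟨ cong σ n≡ ⟨
    σ n                              ≡⟨ σn≡2^kn ⟩
    2 ^ k * n                        ≡⟨ cong (2 ^ k *_) n≡ ⟩
    2 ^ k * (Π * q ^ (2 * β) * P)    ≡⟨ regroup (2 ^ k) Π (q ^ (2 * β)) P ⟩
    q ^ (2 * β) * (2 ^ k * (Π * P))  ∎
    where
    open ≡-Reasoning
    regroup : ∀ t a b c → t * (a * b * c) ≡ b * (t * (a * c))
    regroup = solve-∀
  chain : (q ^ (2 * β) ∣ σ Π) ⇔ (∀ i → OrderCondition q (p i) (suc (2 * βs i)))
  chain = begin
    q ^ (2 * β) ∣ σ Π
      ≈⟨ prime^∣⇔∤ (2 * β) q-prime q∤cofactor σ-factorisation ⟩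
    ¬ (q ∣ geom q (2 * β) * G)
      ≈⟨ prime∤*⇔∤ʳ q-prime (∤geom-self (2 * β) (prime≢1 q-prime)) ⟩
    ¬ (q ∣ G)
      ≈⟨ prime∤∏⇔ s _ q-prime ⟩
    (∀ i → ¬ (q ∣ geom (p i) (2 * βs i)))
      ≈⟨ ∀-cong-⇔ (λ i → ∤geom⇔OrderCondition (2 * βs i) q-prime (prime⇒≢0 (p-prime i))) ⟩
    (∀ i → OrderCondition q (p i) (suc (2 * βs i))) ∎
    where open SetoidReasoning (⇔-setoid 0ℓ)
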